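{- Let $G$ be a globular set and $x,y$ elements of $G$ with $x\triangleleft y$ and $\dim x>\dim y$. Then $t(x)\triangleleft y$ or $t(x)=y$.
   Context: A globular set is a family of sets $(G_n)_{n\in\mathbb N}$ with maps $s,t:G_{n+1}\to G_n$ satisfying $s\circ s=s\circ t$ and $t\circ s=t\circ t$; an element of $G_n$ has dimension $n$. The relation $\triangleleft$ on the elements of $G$ is the transitive closure of the relation generated by $s(x)\triangleleft x\triangleleft t(x)$ for every element $x$ of positive dimension. -}

module Defs where

open import Level using (Level; suc; _⊔_)
open import Data.Nat using (ℕ) renaming (suc to 1+)
open import Data.Product using (Σ; _,_; proj₁)
open import Relation.Binary.PropositionalEquality using (_≡_)
open import Relation.Binary.Construct.Closure.Transitive using (TransClosure)

record GlobularSet (ℓ : Level) : Set (suc ℓ) where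
  field
    G : ℕ → Set ℓ
    s : ∀ {n} → G (1+ n) → G n
    t : ∀ {n} → G (1+ n) → G n
    ss≡st : ∀ {n} (x : G (1+ (1+ n))) → s (s x) ≡ s (t x)
    ts≡tt : ∀ {n} (x : G (1+ (1+ n))) → t (s x) ≡ t (t x)

  El : Set ℓ
  El = Σ ℕ G

  dim : El → ℕ
  dim = proj₁

  data _◃₁_ : El → El → Set ℓ where
    src : ∀ {n} (x : G (1+ n)) → (n , s x) ◃₁ (1+ n , x)
    tgt : ∀ {n} (x : G (1+ n)) → (1+ n , x) ◃₁ (n , t x)

  _◃_ : El → El → Set ℓ
  _◃_ = TransClosure _◃₁_

-- Strengthen the claim to iterated targets: if x ◃ y and
-- dim x ≥ k + 1 + dim y, then the (k+1)-fold target of x is ◃ y or equal to y. A step x ◃₁ t x lowers k by one; a step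
-- s z ◃₁ z raises k by one, which is harmless because the globular identity
-- t ∘ s = t ∘ t makes iterated targets of s z and of z agree.
module Submission where

open import Defs
open import Data.Nat using (ℕ; zero; suc; _+_; _≤_; _>_)
open import Data.Nat.Properties using (≤-pred; m+n≮n)
open import Data.Empty using (⊥-elim)
open import Data.Product using (_,_)
open import Data.Sum using (_⊎_; inj₁; inj₂)
open import Relation.Binary.PropositionalEquality using (_≡_; refl; sym; cong; subst)
open import Relation.Binary.Construct.Closure.Transitive using ([_]; _∷_)

module _ {ℓ} (𝔾 : GlobularSet ℓ) where
  open GlobularSet 𝔾

  t^ : ∀ k {n} → G (k + n) → G n
  t^ zero    a = a
  t^ (suc k) a = t^ k (t a)

  t^-s≡t^-t : ∀ k {n} (z : G (suc (suc k + n))) → t^ (suc k) (s z) ≡ t^ (suc (suc k)) z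
  t^-s≡t^-t k z = cong (t^ k) (ts≡tt z)

  t^-◃⊎≡ : ∀ k {n} (a : G (suc k + n)) (y : El) →
           (suc k + n , a) ◃ y → dim y ≤ n →
           ((n , t^ (suc k) a) ◃ y) ⊎ ((n , t^ (suc k) a) ≡ y)
  t^-◃⊎≡ k       {n} _ _ [ src z ]     le = ⊥-elim (m+n≮n (suc k) n le)
  t^-◃⊎≡ zero        _ _ [ tgt z ]     le = inj₂ refl
  t^-◃⊎≡ (suc k) {n} _ _ [ tgt z ]     le = ⊥-elim (m+n≮n k n le)
  t^-◃⊎≡ k       {n} _ y (src z ∷ p)   le =
    subst (λ b → ((n , b) ◃ y) ⊎ ((n , b) ≡ y)) (sym (t^-s≡t^-t k z))
          (t^-◃⊎≡ (suc k) z y p le)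
  t^-◃⊎≡ zero        _ _ (tgt z ∷ p)   le = inj₁ p
  t^-◃⊎≡ (suc k)     _ y (tgt z ∷ p)   le = t^-◃⊎≡ k (t z) y p le

lemma4p3 : ∀ {ℓ} (𝔾 : GlobularSet ℓ) → let open GlobularSet 𝔾 in
    ∀ {m : ℕ} (x : G (ℕ.suc m)) (y : El) →
    (ℕ.suc m , x) ◃ y → ℕ.suc m > dim y →
    ((m , t x) ◃ y) ⊎ ((m , t x) ≡ y)
lemma4p3 𝔾 x y x◃y dim-y<dim-x = t^-◃⊎≡ 𝔾 0 x y x◃y (≤-pred dim-y<dim-x)
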